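{- If $\mathcal A\subseteq 2^{[n]}$ is a strong $k$-wise eventown, then its linear closure $\overline{\mathcal A}$ is also a strong $k$-wise eventown.
   Context: For $A\subseteq[n]$, $v_A\in\mathbb F_2^n$ denotes its characteristic vector. For $\mathcal A\subseteq 2^{[n]}$ let $V_{\mathcal A}=\mathrm{span}\{v_A:A\in\mathcal A\}$ over $\mathbb F_2$, and the linear closure is $\overline{\mathcal A}=\{A\subseteq[n]: v_A\in V_{\mathcal A}\}$. A family $\{A_1,\ldots,A_m\}$ of distinct subsets of $[n]$ is a $k$-wise eventown if $|\bigcap_{i\in S}A_i|$ is even for every $S\subseteq[m]$ with $|S|=k$, and a strong $k$-wise eventown if it is a $k'$-wise eventown for every $k'\in\{1,\ldots,k\}$. -}

module Defs where

open import Data.Nat using (ℕ; _≤_)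
open import Data.Nat.Divisibility using (_∣_)
open import Data.Bool using (_xor_)
open import Data.Fin.Subset using (Subset; _∩_; ⊤; ⊥; ∣_∣)
open import Data.Vec using (zipWith)
open import Data.List using (List; foldr; length)
open import Data.List.Relation.Unary.All using (All)
open import Data.List.Relation.Unary.Unique.Propositional using (Unique)
open import Data.Product using (Σ; _×_)
open import Relation.Binary.PropositionalEquality using (_≡_)

-- A subset A ⊆ [n] is a Subset n = Vec Bool n; this vector IS its
-- characteristic vector v_A ∈ 𝔽₂ⁿ (true = 1, false = 0).

Family : ℕ → Set₁
Family n = Subset n → Set

_+₂_ : ∀ {n} → Subset n → Subset n → Subset n
_+₂_ = zipWith _xor_

sum₂ : ∀ {n} → List (Subset n) → Subset n
sum₂ = foldr _+₂_ ⊥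

-- v ∈ V_𝒜 = span_{𝔽₂}{v_A : A ∈ 𝒜}: v is a sum of finitely many members
-- (over 𝔽₂ every linear combination is a sum of a finite sub-list).
InSpan : ∀ {n} → Family n → Subset n → Set
InSpan 𝒜 v = Σ (List _) λ Bs → All 𝒜 Bs × sum₂ Bs ≡ v

closure : ∀ {n} → Family n → Family n
closure 𝒜 A = InSpan 𝒜 A

-- Intersection of a list of subsets (used only for nonempty lists).
⋂ : ∀ {n} → List (Subset n) → Subset n
⋂ = foldr _∩_ ⊤

KWiseEventown : ∀ {n} → ℕ → Family n → Set
KWiseEventown k 𝒜 =
  ∀ (As : List _) → length As ≡ k → Unique As → All 𝒜 As → 2 ∣ ∣ ⋂ As ∣

StrongKWiseEventown : ∀ {n} → ℕ → Family n → Set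
StrongKWiseEventown k 𝒜 = ∀ k' → 1 ≤ k' → k' ≤ k → KWiseEventown k' 𝒜

-- The map X ↦ |X ∩ W| mod 2 is 𝔽₂-linear, because
-- |p| + |q| = |p ⊕ q| + 2|p ∩ q|.  Hence evenness of |C₁ ∩ ⋯ ∩ Cⱼ| is
-- multilinear in the Cᵢ, and since every Cᵢ in the closure is a sum of
-- members of 𝒜 it suffices to check intersections of at most k members
-- of 𝒜, possibly with repetitions.  Repetitions do not change the
-- intersection, so these reduce to intersections of at most k distinct
-- members, which are even by the strong eventown hypothesis.
module Submission where

open import Defs
open import Algebra.Bundles using (CommutativeMonoid)
import Algebra.Properties.CommutativeSemigroup as CommutativeSemigroupProperties
import Data.Bool.Properties as Bool
open import Data.Fin using (Fin)
open import Data.Fin.Subset using (Subset; _∩_; ∣_∣; _∈_; _⊆_; inside; outside)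
open import Data.Fin.Subset.Properties
  using (∩-assoc; ∩-identityˡ; ∩-identityʳ; ∩-zeroˡ; ∩-commutativeMonoid; ∣⊥∣≡0; ∈⊤; x∈p∩q⁺; x∈p∩q⁻; ⊆-antisym)
open import Data.List using (List; []; _∷_; length; deduplicate)
open import Data.List.Properties using (length-filter)
open import Data.List.Membership.Propositional.Properties using (∈-deduplicate⁺; ∈-deduplicate⁻)
open import Data.List.Relation.Binary.Subset.Propositional using () renaming (_⊆_ to _⊆ˡ_)
open import Data.List.Relation.Unary.All as All using (All; []; _∷_)
open import Data.List.Relation.Unary.All.Properties using (deduplicate⁺)
open import Data.List.Relation.Unary.Unique.DecPropositional.Properties using (deduplicate-!)
open import Data.Nat using (ℕ; suc; _+_; _*_; _≤_; s≤s; z≤n)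
open import Data.Nat.Divisibility using (_∣_; _∣0; m∣m*n; ∣m∣n⇒∣m+n; ∣m+n∣m⇒∣n)
open import Data.Nat.Properties using (+-suc; *-suc; +-comm; +-identityʳ; ≤-trans; +-commutativeSemigroup)
open import Data.Product using (_,_)
open import Data.Vec using ([]; _∷_)
open import Data.Vec.Properties using (≡-dec; zipWith-distribʳ)
open import Relation.Binary.Definitions using (DecidableEquality)
open import Relation.Binary.PropositionalEquality using (_≡_; refl; sym; trans; cong; subst; module ≡-Reasoning)

EvenSized : ∀ {n} → Subset n → Set
EvenSized p = 2 ∣ ∣ p ∣

∣p∣+∣q∣≡∣p+₂q∣+2∣p∩q∣ : ∀ {n} (p q : Subset n) → ∣ p ∣ + ∣ q ∣ ≡ ∣ p +₂ q ∣ + 2 * ∣ p ∩ q ∣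
∣p∣+∣q∣≡∣p+₂q∣+2∣p∩q∣ []            []            = refl
∣p∣+∣q∣≡∣p+₂q∣+2∣p∩q∣ (outside ∷ p) (outside ∷ q) = ∣p∣+∣q∣≡∣p+₂q∣+2∣p∩q∣ p q
∣p∣+∣q∣≡∣p+₂q∣+2∣p∩q∣ (inside  ∷ p) (outside ∷ q) = cong suc (∣p∣+∣q∣≡∣p+₂q∣+2∣p∩q∣ p q)
∣p∣+∣q∣≡∣p+₂q∣+2∣p∩q∣ (outside ∷ p) (inside  ∷ q) =
  trans (+-suc ∣ p ∣ ∣ q ∣) (cong suc (∣p∣+∣q∣≡∣p+₂q∣+2∣p∩q∣ p q))
∣p∣+∣q∣≡∣p+₂q∣+2∣p∩q∣ (inside  ∷ p) (inside  ∷ q) = begin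
  suc ∣ p ∣ + suc ∣ q ∣              ≡⟨ cong suc (+-suc ∣ p ∣ ∣ q ∣) ⟩
  2 + (∣ p ∣ + ∣ q ∣)                 ≡⟨ cong (2 +_) (∣p∣+∣q∣≡∣p+₂q∣+2∣p∩q∣ p q) ⟩
  2 + (∣ p +₂ q ∣ + 2 * ∣ p ∩ q ∣)   ≡⟨ x∙yz≈y∙xz 2 ∣ p +₂ q ∣ (2 * ∣ p ∩ q ∣) ⟩
  ∣ p +₂ q ∣ + (2 + 2 * ∣ p ∩ q ∣)   ≡⟨ cong (∣ p +₂ q ∣ +_) (sym (*-suc 2 ∣ p ∩ q ∣)) ⟩
  ∣ p +₂ q ∣ + 2 * suc ∣ p ∩ q ∣     ∎
  where
  open ≡-Reasoning
  open CommutativeSemigroupProperties +-commutativeSemigroup using (x∙yz≈y∙xz)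

+₂-preserves-EvenSized : ∀ {n} {p q : Subset n} → EvenSized p → EvenSized q → EvenSized (p +₂ q)
+₂-preserves-EvenSized {p = p} {q} 2∣p 2∣q =
  ∣m+n∣m⇒∣n (subst (2 ∣_) (trans (∣p∣+∣q∣≡∣p+₂q∣+2∣p∩q∣ p q) (+-comm _ (2 * ∣ p ∩ q ∣)))
                  (∣m∣n⇒∣m+n 2∣p 2∣q))
            (m∣m*n ∣ p ∩ q ∣)

∩-distribʳ-+₂ : ∀ {n} (p q r : Subset n) → (p +₂ q) ∩ r ≡ (p ∩ r) +₂ (q ∩ r)
∩-distribʳ-+₂ p q r = zipWith-distribʳ Bool.∧-distribʳ-xor r p q

sum₂-∩-EvenSized : ∀ {n} (W : Subset n) {Bs : List (Subset n)} →
                   All (λ B → EvenSized (B ∩ W)) Bs → EvenSized (sum₂ Bs ∩ W)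
sum₂-∩-EvenSized {n} W [] =
  subst EvenSized (sym (∩-zeroˡ W)) (subst (2 ∣_) (sym (∣⊥∣≡0 n)) (2 ∣0))
sum₂-∩-EvenSized W {B ∷ Bs} (B∩W-even ∷ Bs∩W-even) =
  subst EvenSized (sym (∩-distribʳ-+₂ B (sum₂ Bs) W))
    (+₂-preserves-EvenSized {p = B ∩ W} B∩W-even (sum₂-∩-EvenSized W Bs∩W-even))

module _ {n : ℕ} where

  ∈⋂⁺ : ∀ {x : Fin n} {Xs : List (Subset n)} → All (x ∈_) Xs → x ∈ ⋂ Xs
  ∈⋂⁺ []           = ∈⊤
  ∈⋂⁺ (x∈X ∷ x∈Xs) = x∈p∩q⁺ (x∈X , ∈⋂⁺ x∈Xs)

  ∈⋂⁻ : ∀ {x : Fin n} (Xs : List (Subset n)) → x ∈ ⋂ Xs → All (x ∈_) Xs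
  ∈⋂⁻ []       _     = []
  ∈⋂⁻ (X ∷ Xs) x∈⋂ with x∈p∩q⁻ X (⋂ Xs) x∈⋂
  ... | x∈X , x∈⋂Xs = x∈X ∷ ∈⋂⁻ Xs x∈⋂Xs

  ⋂-antitone : ∀ {Xs Ys : List (Subset n)} → Xs ⊆ˡ Ys → ⋂ Ys ⊆ ⋂ Xs
  ⋂-antitone {Ys = Ys} Xs⊆Ys x∈⋂Ys =
    ∈⋂⁺ (All.tabulate (λ X∈Xs → All.lookup (∈⋂⁻ Ys x∈⋂Ys) (Xs⊆Ys X∈Xs)))

  _≟_ : DecidableEquality (Subset n)
  _≟_ = ≡-dec Bool._≟_

  ⋂-deduplicate : ∀ (Xs : List (Subset n)) → ⋂ (deduplicate _≟_ Xs) ≡ ⋂ Xs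
  ⋂-deduplicate Xs =
    ⊆-antisym (⋂-antitone (∈-deduplicate⁺ _≟_ {Xs})) (⋂-antitone (∈-deduplicate⁻ _≟_ Xs))

length-deduplicate : ∀ {a} {A : Set a} (_≟_ : DecidableEquality A) (xs : List A) →
                     length (deduplicate _≟_ xs) ≤ length xs
length-deduplicate _≟_ []       = z≤n
length-deduplicate _≟_ (x ∷ xs) =
  s≤s (≤-trans (length-filter _ (deduplicate _≟_ xs)) (length-deduplicate _≟_ xs))

module _ {n k : ℕ} {𝒜 : Family n} (eventown : StrongKWiseEventown k 𝒜) where

  StrongKWiseEventown⇒EvenSized-⋂ : ∀ {Xs : List (Subset n)} → All 𝒜 Xs →
                                     1 ≤ length Xs → length Xs ≤ k → EvenSized (⋂ Xs)
  StrongKWiseEventown⇒EvenSized-⋂ {X ∷ Xs} 𝒜Xs _ |Xs|≤k =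
    subst EvenSized (⋂-deduplicate (X ∷ Xs))
      (eventown (length Ys) (s≤s z≤n) (≤-trans (length-deduplicate _≟_ (X ∷ Xs)) |Xs|≤k)
                Ys refl (deduplicate-! _≟_ (X ∷ Xs)) (deduplicate⁺ _≟_ 𝒜Xs))
    where Ys = deduplicate _≟_ (X ∷ Xs)

  -- Ps collects the summands chosen so far from the closure members already expanded.
  closure-EvenSized-⋂ : ∀ {Cs : List (Subset n)} → All (closure 𝒜) Cs →
                        ∀ {Ps : List (Subset n)} → All 𝒜 Ps →
                        1 ≤ length Ps + length Cs → length Ps + length Cs ≤ k →
                        EvenSized (⋂ Ps ∩ ⋂ Cs)
  closure-EvenSized-⋂ {[]} [] {Ps} 𝒜Ps 1≤ ≤k =
    subst EvenSized (sym (∩-identityʳ (⋂ Ps)))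
      (StrongKWiseEventown⇒EvenSized-⋂ 𝒜Ps (subst (1 ≤_) (+-identityʳ _) 1≤) (subst (_≤ k) (+-identityʳ _) ≤k))
  closure-EvenSized-⋂ {_ ∷ Cs} ((Bs , 𝒜Bs , refl) ∷ closureCs) {Ps} 𝒜Ps 1≤ ≤k =
    subst EvenSized (sym (x∙yz≈y∙xz (⋂ Ps) (sum₂ Bs) (⋂ Cs)))
      (sum₂-∩-EvenSized (⋂ Ps ∩ ⋂ Cs) (All.map summand-EvenSized 𝒜Bs))
    where
    open CommutativeSemigroupProperties (CommutativeMonoid.commutativeSemigroup (∩-commutativeMonoid n))
      using (x∙yz≈y∙xz)
    shift : length Ps + suc (length Cs) ≡ suc (length Ps) + length Cs
    shift = +-suc (length Ps) (length Cs)
    summand-EvenSized : ∀ {B} → 𝒜 B → EvenSized (B ∩ (⋂ Ps ∩ ⋂ Cs))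
    summand-EvenSized {B} 𝒜B = subst EvenSized (∩-assoc B (⋂ Ps) (⋂ Cs))
      (closure-EvenSized-⋂ closureCs (𝒜B ∷ 𝒜Ps) (subst (1 ≤_) shift 1≤) (subst (_≤ k) shift ≤k))

lemma3p2 : (n k : ℕ) (𝒜 : Family n) →
    StrongKWiseEventown k 𝒜 → StrongKWiseEventown k (closure 𝒜)
lemma3p2 n k 𝒜 eventown k' 1≤k' k'≤k Cs refl _ closureCs =
  subst EvenSized (∩-identityˡ (⋂ Cs))
    (closure-EvenSized-⋂ eventown closureCs [] 1≤k' k'≤k)
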